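{- Let $G=(A\cup B,E)$ be an instance of the strongly stable matching problem and let $(a,b)\in E$ with $a\in A$, $b\in B$. Let $G_{(a,b)}=(A\cup B,E')$ be the graph obtained from $G$ by the construction described in the context. If $M$ is a strongly stable matching of $G$ with $(a,b)\in M$, then $M\setminus\{(a,b)\}$ is a strongly stable matching of $G_{(a,b)}$ (in particular $M\setminus\{(a,b)\}\subseteq E'$).
   Context: An instance of the strongly stable matching problem (SSMP) is a finite bipartite graph $G=(A\cup B,E)$ (vertices of $A$ are "men", of $B$ "women") in which every vertex $v$ has a preference list: its set of neighbours is partitioned into disjoint "ties" (possibly singletons) which are linearly ordered. For neighbours $x,y$ of $v$ write $x\succ_v y$ if $x$ lies in a strictly earlier tie than $y$ ($v$ strictly prefers $x$), $x=_v y$ if they lie in the same tie, and $x\succeq_v y$ if $x\succ_v y$ or $x=_v y$. A matching is a set of pairwise vertex-disjoint edges; $M(v)$ denotes the partner of $v$ in $M$. An edge $e\in E\setminus M$ blocks $M$ if its endpoints can be labelled $x,y$ so that $x$ is unmatched in $M$ or $y\succ_x M(x)$, and $y$ is unmatched in $M$ or $x\succeq_y M(y)$. A matching is strongly stable if no edge blocks it. Construction of $G_{(a,b)}$: it has vertex set $A\cup B$ and edge set $E'\subseteq E$, with preference lists obtained from those of $G$ by deleting the removed edges. $E'$ is obtained from $E$ by removing: (1) the edge $(a,b)$; (2) every $(a',b)\in E$ with $a\succ_b a'$; (3) every $(a',b)\in E$ with $a=_b a'$, and additionally every $(a',b'')\in E$ with $b\succ_{a'} b''$; (4) every $(a',b)\in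 E$ with $a'\succ_b a$, and additionally every $(a',b'')\in E$ with $b\succeq_{a'} b''$; (5) every $(a,b')\in E$ with $b\succ_a b'$; (6) every $(a,b')\in E$ with $b'=_a b$, and additionally every $(a'',b')\in E$ with $a\succ_{b'} a''$; (7) every $(a,b')\in E$ with $b'\succ_a b$, and additionally every $(a'',b')\in E$ with $a\succeq_{b'} a''$. -}

module Defs where

open import Data.Nat using (ℕ; _<_; _≤_)
open import Data.Fin using (Fin)
open import Data.Product using (_×_; ∃)
open import Data.Sum using (_⊎_)
open import Relation.Nullary using (¬_)
open import Relation.Binary.PropositionalEquality using (_≡_)

EdgeSet : ℕ → ℕ → Set₁
EdgeSet m n = Fin m → Fin n → Set

-- An SSMP instance: a bipartite graph with preference lists given by ranks.
-- rA a b is the position of the tie containing b in a's list (smaller = better);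
-- rB b a likewise.  Ranks are only consulted for neighbours.  Equal rank = same tie.
record Instance (m n : ℕ) : Set₁ where
  field
    E  : EdgeSet m n
    rA : Fin m → Fin n → ℕ
    rB : Fin n → Fin m → ℕ

module _ {m n : ℕ} (rA : Fin m → Fin n → ℕ) (rB : Fin n → Fin m → ℕ) where

  IsMatching : EdgeSet m n → EdgeSet m n → Set
  IsMatching E M =
      (∀ a b → M a b → E a b)
    × (∀ a b b′ → M a b → M a b′ → b ≡ b′)
    × (∀ a a′ b → M a b → M a′ b → a ≡ a′)

  -- man a is unmatched in M or strictly prefers b to M(a)
  ManStrict : EdgeSet m n → Fin m → Fin n → Set
  ManStrict M a b = ∀ b′ → M a b′ → rA a b < rA a b′
  ManWeak : EdgeSet m n → Fin m → Fin n → Set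
  ManWeak M a b = ∀ b′ → M a b′ → rA a b ≤ rA a b′
  WomanStrict : EdgeSet m n → Fin m → Fin n → Set
  WomanStrict M a b = ∀ a′ → M a′ b → rB b a < rB b a′
  WomanWeak : EdgeSet m n → Fin m → Fin n → Set
  WomanWeak M a b = ∀ a′ → M a′ b → rB b a ≤ rB b a′

  Blocks : EdgeSet m n → EdgeSet m n → Fin m → Fin n → Set
  Blocks E M a b = E a b × ¬ M a b ×
    ((ManStrict M a b × WomanWeak M a b) ⊎ (WomanStrict M a b × ManWeak M a b))

  StronglyStable : EdgeSet m n → EdgeSet m n → Set
  StronglyStable E M = IsMatching E M × (∀ a b → ¬ Blocks E M a b)

  Removed : EdgeSet m n → Fin m → Fin n → Fin m → Fin n → Set
  Removed E a b x y =
      -- (1)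
      (x ≡ a × y ≡ b)
      -- (2)
    ⊎ (y ≡ b × rB b a < rB b x)
      -- (3)
    ⊎ (y ≡ b × rB b x ≡ rB b a)
    ⊎ (E x b × rB b x ≡ rB b a × rA x b < rA x y)
      -- (4)
    ⊎ (y ≡ b × rB b x < rB b a)
    ⊎ (E x b × rB b x < rB b a × rA x b ≤ rA x y)
      -- (5)
    ⊎ (x ≡ a × rA a b < rA a y)
      -- (6)
    ⊎ (x ≡ a × rA a y ≡ rA a b)
    ⊎ (E a y × rA a y ≡ rA a b × rB y a < rB y x)
      -- (7)
    ⊎ (x ≡ a × rA a y < rA a b)
    ⊎ (E a y × rA a y < rA a b × rB y a ≤ rB y x)

  -- edge set E' of G_(a,b); preference lists are inherited (same ranks)
  E′ : EdgeSet m n → Fin m → Fin n → EdgeSet m n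
  E′ E a b x y = E x y × ¬ Removed E a b x y

Remove : {m n : ℕ} → EdgeSet m n → Fin m → Fin n → EdgeSet m n
Remove M a b x y = M x y × ¬ (x ≡ a × y ≡ b)

module Submission where

-- Let M be strongly stable in G with (a,b) ∈ M and put
-- M′ = M ∖ {(a,b)}.  Every other edge (x,y) of M avoids both a and b.
--  * M′ ⊆ E′: an edge (x,y) ∈ M′ could only have been removed by one of the
--    rules (3)-(4) through the edge (x,b) or by (6)-(7) through (a,y); in each
--    case the rank conditions of the rule say exactly that this edge blocks M
--    (the partners being y and a, resp. b and x), contradicting stability.
--    All other rules would force x ≡ a or y ≡ b.
--  * M′ is stable in G_(a,b): every edge of E′ avoids a and b (rules (2)-(4)
--    delete all edges at b, rules (5)-(7) all edges at a), so at its endpoints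
--    M′ has the same partners as M; hence a blocking edge for M′ in E′ would be
--    a blocking edge for M in E.

open import Defs
open import Data.Nat using (ℕ; _<_; _≤_)
open import Data.Nat.Properties using (<-cmp; ≤-reflexive)
open import Data.Fin using (Fin)
open import Data.Product using (_×_; _,_; proj₁; proj₂)
open import Data.Sum using (_⊎_; inj₁; inj₂)
open import Relation.Nullary using (¬_)
open import Relation.Binary using (tri<; tri≈; tri>)
open import Relation.Binary.PropositionalEquality using (_≡_; refl; sym; subst)

pattern rule1 p  = inj₁ p
pattern rule2 p  = inj₂ (inj₁ p)
pattern rule3 p  = inj₂ (inj₂ (inj₁ p))
pattern rule3′ p = inj₂ (inj₂ (inj₂ (inj₁ p)))
pattern rule4 p  = inj₂ (inj₂ (inj₂ (inj₂ (inj₁ p))))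
pattern rule4′ p = inj₂ (inj₂ (inj₂ (inj₂ (inj₂ (inj₁ p)))))
pattern rule5 p  = inj₂ (inj₂ (inj₂ (inj₂ (inj₂ (inj₂ (inj₁ p))))))
pattern rule6 p  = inj₂ (inj₂ (inj₂ (inj₂ (inj₂ (inj₂ (inj₂ (inj₁ p)))))))
pattern rule6′ p = inj₂ (inj₂ (inj₂ (inj₂ (inj₂ (inj₂ (inj₂ (inj₂ (inj₁ p))))))))
pattern rule7 p  = inj₂ (inj₂ (inj₂ (inj₂ (inj₂ (inj₂ (inj₂ (inj₂ (inj₂ (inj₁ p)))))))))
pattern rule7′ p = inj₂ (inj₂ (inj₂ (inj₂ (inj₂ (inj₂ (inj₂ (inj₂ (inj₂ (inj₂ p)))))))))

module _ {m n : ℕ} (rA : Fin m → Fin n → ℕ) (rB : Fin n → Fin m → ℕ) where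

  blockingAgainstPartners : ∀ {E M x y x′ y′} → IsMatching rA rB E M →
    E x y → ¬ M x y → M x y′ → M x′ y →
    (rA x y < rA x y′ × rB y x ≤ rB y x′) ⊎ (rB y x < rB y x′ × rA x y ≤ rA x y′) →
    Blocks rA rB E M x y
  blockingAgainstPartners {M = M} {x} {y} {x′} {y′} (_ , uniqueA , uniqueB) exy ¬mxy mxy′ mx′y ranks =
    exy , ¬mxy , conditions ranks
    where
    atMan : ∀ {R : ℕ → ℕ → Set} → R (rA x y) (rA x y′) → ∀ z → M x z → R (rA x y) (rA x z)
    atMan {R} r z mxz = subst (λ w → R (rA x y) (rA x w)) (uniqueA x y′ z mxy′ mxz) r
    atWoman : ∀ {R : ℕ → ℕ → Set} → R (rB y x) (rB y x′) → ∀ z → M z y → R (rB y x) (rB y z)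
    atWoman {R} r z mzy = subst (λ w → R (rB y x) (rB y w)) (uniqueB x′ z y mx′y mzy) r
    conditions : (rA x y < rA x y′ × rB y x ≤ rB y x′) ⊎ (rB y x < rB y x′ × rA x y ≤ rA x y′) →
                 (ManStrict rA rB M x y × WomanWeak rA rB M x y)
                 ⊎ (WomanStrict rA rB M x y × ManWeak rA rB M x y)
    conditions (inj₁ (man< , woman≤)) = inj₁ (atMan {_<_} man< , atWoman {_≤_} woman≤)
    conditions (inj₂ (woman< , man≤)) = inj₂ (atWoman {_<_} woman< , atMan {_≤_} man≤)

  blocksTransfer : ∀ {E E′ M M′ x y} → (E′ x y → E x y) →
    (∀ {z} → M x z → M′ x z) → (∀ {z} → M z y → M′ z y) →
    Blocks rA rB E′ M′ x y → Blocks rA rB E M x y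
  blocksTransfer inE atX atY (exy , ¬m′xy , inj₁ (man< , woman≤)) =
    inE exy , (λ mxy → ¬m′xy (atX mxy)) ,
    inj₁ ((λ z mxz → man< z (atX mxz)) , (λ z mzy → woman≤ z (atY mzy)))
  blocksTransfer inE atX atY (exy , ¬m′xy , inj₂ (woman< , man≤)) =
    inE exy , (λ mxy → ¬m′xy (atX mxy)) ,
    inj₂ ((λ z mzy → woman< z (atY mzy)) , (λ z mxz → man≤ z (atX mxz)))

  submatching : ∀ {E E′ M M′} → IsMatching rA rB E M →
    (∀ x y → M′ x y → M x y) → (∀ x y → M′ x y → E′ x y) → IsMatching rA rB E′ M′
  submatching (_ , uniqueA , uniqueB) M′⊆M M′⊆E′ =
    M′⊆E′ ,
    (λ x y y′ p q → uniqueA x y y′ (M′⊆M x y p) (M′⊆M x y′ q)) ,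
    (λ x x′ y p q → uniqueB x x′ y (M′⊆M x y p) (M′⊆M x′ y q))

module _ {m n : ℕ} (rA : Fin m → Fin n → ℕ) (rB : Fin n → Fin m → ℕ)
         (E : EdgeSet m n) (a : Fin m) (b : Fin n) where

  E′⊆E : ∀ {x y} → E′ rA rB E a b x y → E x y
  E′⊆E = proj₁

  -- Rules (5)-(7) delete every edge at a, whatever its rank.
  E′-avoids-a : ∀ {x y} → E′ rA rB E a b x y → ¬ x ≡ a
  E′-avoids-a {y = y} (_ , kept) refl with <-cmp (rA a b) (rA a y)
  ... | tri< b<y _ _ = kept (rule5 (refl , b<y))
  ... | tri≈ _ b≡y _ = kept (rule6 (refl , sym b≡y))
  ... | tri> _ _ y<b = kept (rule7 (refl , y<b))

  -- Rules (2)-(4) delete every edge at b, whatever its rank.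
  E′-avoids-b : ∀ {x y} → E′ rA rB E a b x y → ¬ y ≡ b
  E′-avoids-b {x = x} (_ , kept) refl with <-cmp (rB b a) (rB b x)
  ... | tri< a<x _ _ = kept (rule2 (refl , a<x))
  ... | tri≈ _ a≡x _ = kept (rule3 (refl , sym a≡x))
  ... | tri> _ _ x<a = kept (rule4 (refl , x<a))

module _ {m n : ℕ} (G : Instance m n) (a : Fin m) (b : Fin n) (M : EdgeSet m n)
         (matching : IsMatching (Instance.rA G) (Instance.rB G) (Instance.E G) M)
         (noBlock : ∀ x y → ¬ Blocks (Instance.rA G) (Instance.rB G) (Instance.E G) M x y)
         (mab : M a b) where

  open Instance G

  private
    uniqueA : ∀ x y y′ → M x y → M x y′ → y ≡ y′
    uniqueA = proj₁ (proj₂ matching)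
    uniqueB : ∀ x x′ y → M x y → M x′ y → x ≡ x′
    uniqueB = proj₂ (proj₂ matching)

  otherEdge-avoids-a : ∀ {x y} → M x y → ¬ (x ≡ a × y ≡ b) → ¬ x ≡ a
  otherEdge-avoids-a {y = y} mxy notAB refl = notAB (refl , uniqueA a y b mxy mab)

  otherEdge-avoids-b : ∀ {x y} → M x y → ¬ (x ≡ a × y ≡ b) → ¬ y ≡ b
  otherEdge-avoids-b {x = x} mxy notAB refl = notAB (uniqueB x a b mxy mab , refl)

  otherEdge-man-not-at-b : ∀ {x y} → M x y → ¬ (x ≡ a × y ≡ b) → ¬ M x b
  otherEdge-man-not-at-b {x} mxy notAB mxb = otherEdge-avoids-a mxy notAB (uniqueB x a b mxb mab)

  otherEdge-woman-not-at-a : ∀ {x y} → M x y → ¬ (x ≡ a × y ≡ b) → ¬ M a y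
  otherEdge-woman-not-at-a {y = y} mxy notAB may = otherEdge-avoids-b mxy notAB (sym (uniqueA a b y mab may))

  survives : ∀ {x y} → M x y → ¬ (x ≡ a × y ≡ b) → ¬ Removed rA rB E a b x y
  survives mxy notAB (rule1 xy≡ab) = notAB xy≡ab
  survives mxy notAB (rule2 (y≡b , _)) = otherEdge-avoids-b mxy notAB y≡b
  survives mxy notAB (rule3 (y≡b , _)) = otherEdge-avoids-b mxy notAB y≡b
  survives mxy notAB (rule4 (y≡b , _)) = otherEdge-avoids-b mxy notAB y≡b
  survives mxy notAB (rule5 (x≡a , _)) = otherEdge-avoids-a mxy notAB x≡a
  survives mxy notAB (rule6 (x≡a , _)) = otherEdge-avoids-a mxy notAB x≡a
  survives mxy notAB (rule7 (x≡a , _)) = otherEdge-avoids-a mxy notAB x≡a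
  -- second halves of rules (3),(4): the edge (x,b) would block M, since x is
  -- matched to y and b to a
  survives {x} mxy notAB (rule3′ (exb , tie , b<y)) =
    noBlock x b (blockingAgainstPartners rA rB matching exb
                   (otherEdge-man-not-at-b mxy notAB) mxy mab (inj₁ (b<y , ≤-reflexive tie)))
  survives {x} mxy notAB (rule4′ (exb , x<a , b≤y)) =
    noBlock x b (blockingAgainstPartners rA rB matching exb
                   (otherEdge-man-not-at-b mxy notAB) mxy mab (inj₂ (x<a , b≤y)))
  -- second halves of rules (6),(7): the edge (a,y) would block M, since a is
  -- matched to b and y to x
  survives {y = y} mxy notAB (rule6′ (eay , tie , a<x)) =
    noBlock a y (blockingAgainstPartners rA rB matching eay
                   (otherEdge-woman-not-at-a mxy notAB) mab mxy (inj₂ (a<x , ≤-reflexive tie)))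
  survives {y = y} mxy notAB (rule7′ (eay , y<b , a≤x)) =
    noBlock a y (blockingAgainstPartners rA rB matching eay
                   (otherEdge-woman-not-at-a mxy notAB) mab mxy (inj₁ (y<b , a≤x)))

  remainder-matching : IsMatching rA rB (E′ rA rB E a b) (Remove M a b)
  remainder-matching =
    submatching rA rB matching (λ _ _ → proj₁)
      (λ x y (mxy , notAB) → proj₁ matching x y mxy , survives mxy notAB)

  -- No edge of G_(a,b) blocks M ∖ {(a,b)}: at the endpoints of such an edge,
  -- which avoid a and b, the partners in M and in M ∖ {(a,b)} agree.
  remainder-unblocked : ∀ x y → ¬ Blocks rA rB (E′ rA rB E a b) (Remove M a b) x y
  remainder-unblocked x y blocking@(e′xy , _) =
    noBlock x y (blocksTransfer rA rB {E = E} {E′ = E′ rA rB E a b} (E′⊆E rA rB E a b)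
                   (λ mxz → mxz , λ (x≡a , _) → E′-avoids-a rA rB E a b e′xy x≡a)
                   (λ mzy → mzy , λ (_ , y≡b) → E′-avoids-b rA rB E a b e′xy y≡b)
                   blocking)

lemma2 : {m n : ℕ} (G : Instance m n) (a : Fin m) (b : Fin n) →
    Instance.E G a b →
    (M : EdgeSet m n) →
    StronglyStable (Instance.rA G) (Instance.rB G) (Instance.E G) M →
    M a b →
    StronglyStable (Instance.rA G) (Instance.rB G)
      (E′ (Instance.rA G) (Instance.rB G) (Instance.E G) a b) (Remove M a b)
lemma2 G a b _ M (matching , noBlock) mab =
  remainder-matching G a b M matching noBlock mab ,
  remainder-unblocked G a b M matching noBlock mab
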